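{- Let $m$ be a positive integer and $n=2m$. Suppose that $N$ is a subset of the cyclic group $\mathbb{Z}_{2m}$ such that $\{0,m\}\subseteq N$ and $|N|$ is odd. Then $N$ is not a direct factor of $\mathbb{Z}_{2m}$.
   Context: $\mathbb{Z}_{2m}$ is the additive group of integers modulo $2m$. A subset $N$ of an abelian group $G$ is a direct factor of $G$ if there is a subset $A\subseteq G$ such that every element of $G$ can be written uniquely as $x+a$ with $x\in N$, $a\in A$. -}

module Defs where

open import Data.Nat using (ℕ; NonZero) renaming (_+_ to _+ℕ_)
open import Data.Nat.DivMod using (_%_; m%n<n)
open import Data.Fin using (Fin; toℕ; fromℕ<)
open import Data.Fin.Subset using (Subset; _∈_)
open import Data.Product using (Σ; _×_)
open import Relation.Binary.PropositionalEquality using (_≡_)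

addMod : (n : ℕ) .{{_ : NonZero n}} → Fin n → Fin n → Fin n
addMod n x y = fromℕ< (m%n<n (toℕ x +ℕ toℕ y) n)

IsDirectFactor : (n : ℕ) .{{_ : NonZero n}} → Subset n → Set
IsDirectFactor n N =
  Σ (Subset n) λ A →
    (∀ g → Σ (Fin n) λ x → Σ (Fin n) λ a → x ∈ N × a ∈ A × addMod n x a ≡ g) ×
    (∀ x a x′ a′ → x ∈ N → a ∈ A → x′ ∈ N → a′ ∈ A →
       addMod n x a ≡ addMod n x′ a′ → x ≡ x′ × a ≡ a′)

-- Suppose N ⊕ A = ℤ_n and let rep₂ g be the number of x ∈ N with g - 2x ∈ A.
-- Counting pairs (x, a) gives Σ_g rep₂ g = |N| |A| = n.  For fixed g the pairs
-- (x, y) ∈ N² with g - x - y ∈ A form a symmetric relation with exactly one y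
-- for each x, so rep₂ g, the number of its diagonal entries, has the parity of
-- |N|; when |N| is odd every rep₂ g is at least 1.  But 0 and m are distinct
-- elements of N with 2·0 = 2·m, so rep₂ (2·0 + a) ≥ 2 for any a ∈ A, and the
-- sum exceeds n.
module Submission where

open import Defs
open import Data.Nat using (ℕ; NonZero; zero; suc; _*_; _+_; _∸_; _≤_; _<_; z≤n; s≤s)
open import Data.Nat.Properties
open import Data.Nat.DivMod using (_%_; m%n<n; m<n⇒m%n≡m; m%n%n≡m%n; %-distribˡ-+; [m+n]%n≡m%n; n%n≡0)
open import Data.Nat.Tactic.RingSolver using (solve-∀)
open import Data.Bool using (Bool; true; false)
open import Data.Vec using ([]; _∷_; lookup)
open import Data.Vec.Properties using ([]=⇒lookup; lookup⇒[]=)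
open import Data.Fin using (Fin; zero; suc; fromℕ<; toℕ; punchIn; punchOut)
open import Data.Fin.Properties using (toℕ-fromℕ<; toℕ-injective; toℕ<n; punchInᵢ≢i; punchIn-punchOut)
open import Data.Fin.Permutation using (permutation)
open import Data.Fin.Subset using (Subset; _∈_; ∣_∣)
open import Data.Product using (∃; _,_; proj₁; proj₂)
open import Function using (_∘_)
open import Data.Vec.Functional using (replicate)
open import Relation.Binary.PropositionalEquality
open import Relation.Nullary using (¬_; contradiction)
open import Algebra.Properties.Semiring.Sum +-*-semiring
  using (sum; sum-remove; sum-replicate-zero; ∑-comm; ∑-distrib-+; ∑-permute; sum-cong-≗; *-distribˡ-sum)
import Algebra.Properties.CommutativeSemigroup as CommSemigroupProperties

private
  module +-Props = CommSemigroupProperties +-commutativeSemigroup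
  module *-Props = CommSemigroupProperties *-commutativeSemigroup

sum-ones : ∀ n → sum {n} (λ _ → 1) ≡ n
sum-ones zero = refl
sum-ones (suc n) = cong suc (sum-ones n)

sum-vanishing-off : ∀ {n} (f : Fin n → ℕ) i → (∀ j → j ≢ i → f j ≡ 0) → sum f ≡ f i
sum-vanishing-off {suc n} f i vanish = begin
  sum f                                ≡⟨ sum-remove f ⟩
  f i + sum (f ∘ punchIn i)            ≡⟨ cong (f i +_) (sum-cong-≗ (λ j → vanish (punchIn i j) (punchInᵢ≢i i j))) ⟩
  f i + sum (replicate n 0)            ≡⟨ cong (f i +_) (sum-replicate-zero n) ⟩
  f i + 0                              ≡⟨ +-identityʳ (f i) ⟩
  f i                                  ∎
  where open ≡-Reasoning

lookup≤sum : ∀ {n} (f : Fin n → ℕ) i → f i ≤ sum f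
lookup≤sum {suc n} f i = ≤-trans (m≤m+n (f i) _) (≤-reflexive (sym (sum-remove f)))

lookup+lookup≤sum : ∀ {n} (f : Fin n → ℕ) {i j} → i ≢ j → f i + f j ≤ sum f
lookup+lookup≤sum {suc n} f {i} {j} i≢j = begin
  f i + f j                                    ≡⟨ cong (λ k → f i + f k) (sym (punchIn-punchOut i≢j)) ⟩
  f i + f (punchIn i (punchOut i≢j))           ≤⟨ +-monoʳ-≤ (f i) (lookup≤sum (f ∘ punchIn i) (punchOut i≢j)) ⟩
  f i + sum (f ∘ punchIn i)                    ≡⟨ sum-remove f ⟨
  sum f                                        ∎
  where open ≤-Reasoning

n≤sum-of-positive : ∀ {n} (f : Fin n → ℕ) → (∀ i → 1 ≤ f i) → n ≤ sum f
n≤sum-of-positive {zero} f positive = z≤n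
n≤sum-of-positive {suc n} f positive = +-mono-≤ (positive zero) (n≤sum-of-positive (f ∘ suc) (positive ∘ suc))

n<sum-of-positive : ∀ {n} (f : Fin n → ℕ) → (∀ i → 1 ≤ f i) → ∀ i → 2 ≤ f i → n < sum f
n<sum-of-positive {suc n} f positive i 2≤fi = begin
  2 + n                        ≤⟨ +-mono-≤ 2≤fi (n≤sum-of-positive (f ∘ punchIn i) (positive ∘ punchIn i)) ⟩
  f i + sum (f ∘ punchIn i)    ≡⟨ sum-remove f ⟨
  sum f                        ∎
  where open ≤-Reasoning

symmetric⇒sum≡trace+even : ∀ {n} (M : Fin n → Fin n → ℕ) → (∀ i j → M i j ≡ M j i) →
  ∃ λ q → sum (λ i → sum (M i)) ≡ sum (λ i → M i i) + 2 * q
symmetric⇒sum≡trace+even {zero} M symmetric = 0 , refl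
symmetric⇒sum≡trace+even {suc n} M symmetric
  with q , eq ← symmetric⇒sum≡trace+even (λ i j → M (suc i) (suc j)) (λ i j → symmetric (suc i) (suc j))
  = q + row , (begin
    (M zero zero + row) + sum (λ i → M (suc i) zero + sum (λ j → M (suc i) (suc j)))
      ≡⟨ cong ((M zero zero + row) +_) (∑-distrib-+ (λ i → M (suc i) zero) (λ i → sum (λ j → M (suc i) (suc j)))) ⟩
    (M zero zero + row) + (sum (λ i → M (suc i) zero) + sum (λ i → sum (λ j → M (suc i) (suc j))))
      ≡⟨ cong₂ (λ c rest → (M zero zero + row) + (c + rest)) (sum-cong-≗ (λ i → symmetric (suc i) zero)) eq ⟩
    (M zero zero + row) + (row + (trace + 2 * q))
      ≡⟨ regroup (M zero zero) row trace q ⟩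
    (M zero zero + trace) + 2 * (q + row) ∎)
  where
  open ≡-Reasoning
  row trace : ℕ
  row = sum (λ j → M zero (suc j))
  trace = sum (λ i → M (suc i) (suc i))
  regroup : ∀ a r d q → (a + r) + (r + (d + 2 * q)) ≡ (a + d) + 2 * (q + r)
  regroup = solve-∀

𝟙 : Bool → ℕ
𝟙 true = 1
𝟙 false = 0

𝟙-absorb : ∀ b k → 𝟙 b * (𝟙 b * k) ≡ 𝟙 b * k
𝟙-absorb true k = *-identityˡ (1 * k)
𝟙-absorb false k = refl

∣p∣≡sum-𝟙 : ∀ {n} (p : Subset n) → ∣ p ∣ ≡ sum (𝟙 ∘ lookup p)
∣p∣≡sum-𝟙 [] = refl
∣p∣≡sum-𝟙 (true ∷ p) = cong suc (∣p∣≡sum-𝟙 p)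
∣p∣≡sum-𝟙 (false ∷ p) = ∣p∣≡sum-𝟙 p

module ℤₙ (n : ℕ) .{{_ : NonZero n}} where
  open ≡-Reasoning

  reduce : ℕ → Fin n
  reduce k = fromℕ< (m%n<n k n)

  _⊕_ : Fin n → Fin n → Fin n
  _⊕_ = addMod n

  _⊖_ : Fin n → Fin n → Fin n
  g ⊖ x = reduce (toℕ g + (n ∸ toℕ x))

  reduce-cong : ∀ {j k} → j % n ≡ k % n → reduce j ≡ reduce k
  reduce-cong {j} {k} eq = toℕ-injective (begin
    toℕ (reduce j)    ≡⟨ toℕ-fromℕ< _ ⟩
    j % n             ≡⟨ eq ⟩
    k % n             ≡⟨ toℕ-fromℕ< _ ⟨
    toℕ (reduce k)    ∎)

  reduce-toℕ : ∀ x → reduce (toℕ x) ≡ x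
  reduce-toℕ x = toℕ-injective (trans (toℕ-fromℕ< _) (m<n⇒m%n≡m (toℕ<n x)))

  reduce-reduceˡ : ∀ j k → reduce (toℕ (reduce j) + k) ≡ reduce (j + k)
  reduce-reduceˡ j k = reduce-cong (begin
    (toℕ (reduce j) + k) % n       ≡⟨ cong (λ r → (r + k) % n) (toℕ-fromℕ< _) ⟩
    (j % n + k) % n                ≡⟨ %-distribˡ-+ (j % n) k n ⟩
    (j % n % n + k % n) % n        ≡⟨ cong (λ r → (r + k % n) % n) (m%n%n≡m%n j n) ⟩
    (j % n + k % n) % n            ≡⟨ %-distribˡ-+ j k n ⟨
    (j + k) % n                    ∎)

  reduce-reduceʳ : ∀ j k → reduce (j + toℕ (reduce k)) ≡ reduce (j + k)
  reduce-reduceʳ j k = begin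
    reduce (j + toℕ (reduce k))    ≡⟨ cong reduce (+-comm j _) ⟩
    reduce (toℕ (reduce k) + j)    ≡⟨ reduce-reduceˡ k j ⟩
    reduce (k + j)                 ≡⟨ cong reduce (+-comm k j) ⟩
    reduce (j + k)                 ∎

  reduce-complement : ∀ j x → reduce (j + (toℕ x + (n ∸ toℕ x))) ≡ reduce j
  reduce-complement j x = reduce-cong (begin
    (j + (toℕ x + (n ∸ toℕ x))) % n    ≡⟨ cong (λ r → (j + r) % n) (m+[n∸m]≡n (<⇒≤ (toℕ<n x))) ⟩
    (j + n) % n                        ≡⟨ [m+n]%n≡m%n j n ⟩
    j % n                              ∎)

  ⊕-comm : ∀ x y → x ⊕ y ≡ y ⊕ x
  ⊕-comm x y = cong reduce (+-comm (toℕ x) (toℕ y))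

  ⊕-assoc : ∀ x y z → (x ⊕ y) ⊕ z ≡ x ⊕ (y ⊕ z)
  ⊕-assoc x y z = begin
    reduce (toℕ (reduce (toℕ x + toℕ y)) + toℕ z)   ≡⟨ reduce-reduceˡ (toℕ x + toℕ y) (toℕ z) ⟩
    reduce (toℕ x + toℕ y + toℕ z)                  ≡⟨ cong reduce (+-assoc (toℕ x) (toℕ y) (toℕ z)) ⟩
    reduce (toℕ x + (toℕ y + toℕ z))                ≡⟨ reduce-reduceʳ (toℕ x) (toℕ y + toℕ z) ⟨
    reduce (toℕ x + toℕ (reduce (toℕ y + toℕ z)))   ∎

  ⊕-⊖-cancel : ∀ x g → x ⊕ (g ⊖ x) ≡ g
  ⊕-⊖-cancel x g = begin
    reduce (toℕ x + toℕ (reduce (toℕ g + (n ∸ toℕ x))))   ≡⟨ reduce-reduceʳ (toℕ x) _ ⟩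
    reduce (toℕ x + (toℕ g + (n ∸ toℕ x)))                ≡⟨ cong reduce (+-Props.x∙yz≈y∙xz (toℕ x) (toℕ g) _) ⟩
    reduce (toℕ g + (toℕ x + (n ∸ toℕ x)))                ≡⟨ reduce-complement (toℕ g) x ⟩
    reduce (toℕ g)                                        ≡⟨ reduce-toℕ g ⟩
    g                                                     ∎

  ⊖-⊕-cancel : ∀ x a → (x ⊕ a) ⊖ x ≡ a
  ⊖-⊕-cancel x a = begin
    reduce (toℕ (reduce (toℕ x + toℕ a)) + (n ∸ toℕ x))   ≡⟨ reduce-reduceˡ (toℕ x + toℕ a) _ ⟩
    reduce (toℕ x + toℕ a + (n ∸ toℕ x))                  ≡⟨ cong reduce (+-Props.xy∙z≈y∙xz (toℕ x) (toℕ a) _) ⟩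
    reduce (toℕ a + (toℕ x + (n ∸ toℕ x)))                ≡⟨ reduce-complement (toℕ a) x ⟩
    reduce (toℕ a)                                        ≡⟨ reduce-toℕ a ⟩
    a                                                     ∎

  ⊖-unique : ∀ {x a g} → x ⊕ a ≡ g → a ≡ g ⊖ x
  ⊖-unique {x} {a} eq = trans (sym (⊖-⊕-cancel x a)) (cong (_⊖ x) eq)

  ⊖-⊖ : ∀ g x y → (g ⊖ x) ⊖ y ≡ g ⊖ (x ⊕ y)
  ⊖-⊖ g x y = ⊖-unique (begin
    (x ⊕ y) ⊕ ((g ⊖ x) ⊖ y)    ≡⟨ ⊕-assoc x y _ ⟩
    x ⊕ (y ⊕ ((g ⊖ x) ⊖ y))    ≡⟨ cong (x ⊕_) (⊕-⊖-cancel y (g ⊖ x)) ⟩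
    x ⊕ (g ⊖ x)                ≡⟨ ⊕-⊖-cancel x g ⟩
    g                          ∎)

  ⊖-⊖-comm : ∀ g x y → (g ⊖ x) ⊖ y ≡ (g ⊖ y) ⊖ x
  ⊖-⊖-comm g x y = trans (⊖-⊖ g x y) (trans (cong (g ⊖_) (⊕-comm x y)) (sym (⊖-⊖ g y x)))

  sum-⊖-invariant : ∀ x (h : Fin n → ℕ) → sum (λ g → h (g ⊖ x)) ≡ sum h
  sum-⊖-invariant x h = sym (∑-permute h (permutation (_⊖ x) (x ⊕_) (⊖-⊕-cancel x) (⊕-⊖-cancel x)))

module DirectFactor {n : ℕ} .{{_ : NonZero n}} (N : Subset n) (N⊕A : IsDirectFactor n N) where
  open ℤₙ n
  open ≡-Reasoning

  A : Subset n
  A = proj₁ N⊕A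

  rep : Fin n → Fin n → ℕ
  rep g x = 𝟙 (lookup N x) * 𝟙 (lookup A (g ⊖ x))

  rep≡1 : ∀ {g x a} → x ∈ N → a ∈ A → g ⊖ x ≡ a → rep g x ≡ 1
  rep≡1 x∈N a∈A g⊖x≡a =
    cong₂ (λ b c → 𝟙 b * 𝟙 c) ([]=⇒lookup x∈N) (trans (cong (lookup A) g⊖x≡a) ([]=⇒lookup a∈A))

  sum-rep≡1 : ∀ g → sum (rep g) ≡ 1
  sum-rep≡1 g with x₀ , a₀ , x₀∈N , a₀∈A , x₀⊕a₀≡g ← proj₁ (proj₂ N⊕A) g =
    trans (sum-vanishing-off (rep g) x₀ rep≡0) (rep≡1 x₀∈N a₀∈A (sym (⊖-unique x₀⊕a₀≡g)))
    where
    rep≡0 : ∀ x → x ≢ x₀ → rep g x ≡ 0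
    rep≡0 x x≢x₀ with lookup N x in x∈N | lookup A (g ⊖ x) in g⊖x∈A
    ... | false | _ = refl
    ... | true | false = refl
    ... | true | true = contradiction
      (proj₁ (proj₂ (proj₂ N⊕A) x (g ⊖ x) x₀ a₀ (lookup⇒[]= x N x∈N) (lookup⇒[]= (g ⊖ x) A g⊖x∈A) x₀∈N a₀∈A
        (trans (⊕-⊖-cancel x g) (sym x₀⊕a₀≡g))))
      x≢x₀

  rep₂ : Fin n → ℕ
  rep₂ g = sum (λ x → rep (g ⊖ x) x)

  sum-rep₂≡n : sum rep₂ ≡ n
  sum-rep₂≡n = begin
    sum (λ g → sum (λ x → rep (g ⊖ x) x))   ≡⟨ ∑-comm (λ g x → rep (g ⊖ x) x) ⟩
    sum (λ x → sum (λ g → rep (g ⊖ x) x))   ≡⟨ sum-cong-≗ (λ x → sum-⊖-invariant x (λ h → rep h x)) ⟩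
    sum (λ x → sum (λ h → rep h x))         ≡⟨ ∑-comm rep ⟨
    sum (λ h → sum (rep h))                 ≡⟨ sum-cong-≗ sum-rep≡1 ⟩
    sum {n} (λ _ → 1)                       ≡⟨ sum-ones n ⟩
    n                                       ∎

  pairs : Fin n → Fin n → Fin n → ℕ
  pairs g x y = 𝟙 (lookup N x) * rep (g ⊖ x) y

  pairs-symmetric : ∀ g x y → pairs g x y ≡ pairs g y x
  pairs-symmetric g x y = begin
    𝟙 (lookup N x) * (𝟙 (lookup N y) * 𝟙 (lookup A ((g ⊖ x) ⊖ y)))
      ≡⟨ cong (λ c → 𝟙 (lookup N x) * (𝟙 (lookup N y) * 𝟙 (lookup A c))) (⊖-⊖-comm g x y) ⟩
    𝟙 (lookup N x) * (𝟙 (lookup N y) * 𝟙 (lookup A ((g ⊖ y) ⊖ x)))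
      ≡⟨ *-Props.x∙yz≈y∙xz (𝟙 (lookup N x)) (𝟙 (lookup N y)) _ ⟩
    𝟙 (lookup N y) * (𝟙 (lookup N x) * 𝟙 (lookup A ((g ⊖ y) ⊖ x)))
      ∎

  sum-pairs-row : ∀ g x → sum (pairs g x) ≡ 𝟙 (lookup N x)
  sum-pairs-row g x = begin
    sum (pairs g x)                        ≡⟨ *-distribˡ-sum (𝟙 (lookup N x)) (rep (g ⊖ x)) ⟨
    𝟙 (lookup N x) * sum (rep (g ⊖ x))     ≡⟨ cong (𝟙 (lookup N x) *_) (sum-rep≡1 (g ⊖ x)) ⟩
    𝟙 (lookup N x) * 1                     ≡⟨ *-identityʳ _ ⟩
    𝟙 (lookup N x)                         ∎

  pairs-diagonal : ∀ g x → pairs g x x ≡ rep (g ⊖ x) x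
  pairs-diagonal g x = 𝟙-absorb (lookup N x) _

  rep₂-parity : ∀ g → ∃ λ q → ∣ N ∣ ≡ rep₂ g + 2 * q
  rep₂-parity g with q , eq ← symmetric⇒sum≡trace+even (pairs g) (pairs-symmetric g) = q , (begin
    ∣ N ∣                                 ≡⟨ ∣p∣≡sum-𝟙 N ⟩
    sum (𝟙 ∘ lookup N)                    ≡⟨ sum-cong-≗ (sum-pairs-row g) ⟨
    sum (λ x → sum (pairs g x))           ≡⟨ eq ⟩
    sum (λ x → pairs g x x) + 2 * q       ≡⟨ cong (_+ 2 * q) (sum-cong-≗ (pairs-diagonal g)) ⟩
    rep₂ g + 2 * q                        ∎)

  rep₂-collision : ∀ {x y a} → x ∈ N → y ∈ N → x ≢ y → x ⊕ x ≡ y ⊕ y → a ∈ A →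
    2 ≤ rep₂ ((x ⊕ x) ⊕ a)
  rep₂-collision {x} {y} {a} x∈N y∈N x≢y 2x≡2y a∈A =
    subst (_≤ rep₂ g) (cong₂ _+_ (term≡1 x∈N refl) (term≡1 y∈N (sym 2x≡2y)))
      (lookup+lookup≤sum (λ z → rep (g ⊖ z) z) x≢y)
    where
    g : Fin n
    g = (x ⊕ x) ⊕ a
    term≡1 : ∀ {z} → z ∈ N → z ⊕ z ≡ x ⊕ x → rep (g ⊖ z) z ≡ 1
    term≡1 {z} z∈N 2z≡2x = rep≡1 z∈N a∈A (begin
      (g ⊖ z) ⊖ z    ≡⟨ ⊖-⊖ g z z ⟩
      g ⊖ (z ⊕ z)    ≡⟨ cong (g ⊖_) 2z≡2x ⟩
      g ⊖ (x ⊕ x)    ≡⟨ ⊖-⊕-cancel (x ⊕ x) a ⟩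
      a              ∎)

odd-doubling-collision⇒¬IsDirectFactor : ∀ n .{{_ : NonZero n}} (N : Subset n) {x y : Fin n} →
  x ∈ N → y ∈ N → x ≢ y → addMod n x x ≡ addMod n y y → (∃ λ t → ∣ N ∣ ≡ suc (2 * t)) →
  ¬ IsDirectFactor n N
odd-doubling-collision⇒¬IsDirectFactor n N {x} x∈N y∈N x≢y 2x≡2y (t , odd) N⊕A
  with _ , a , _ , a∈A , _ ← proj₁ (proj₂ N⊕A) x =
  <-irrefl (sym sum-rep₂≡n) (n<sum-of-positive rep₂ rep₂-positive _ (rep₂-collision x∈N y∈N x≢y 2x≡2y a∈A))
  where
  open DirectFactor N N⊕A
  rep₂-positive : ∀ g → 1 ≤ rep₂ g
  rep₂-positive g with rep₂ g | rep₂-parity g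
  ... | zero | q , even = contradiction (trans (sym even) odd) (even≢odd q t)
  ... | suc _ | _ = s≤s z≤n

theorem3p4 : (k : ℕ) (N : Subset (2 * suc k)) →
    zero ∈ N →
    fromℕ< {suc k} {2 * suc k} (m<m+n (suc k) {suc k + 0} (s≤s z≤n)) ∈ N →
    (∃ λ t → ∣ N ∣ ≡ suc (2 * t)) →
    ¬ IsDirectFactor (2 * suc k) N
theorem3p4 k N 0∈N m∈N = odd-doubling-collision⇒¬IsDirectFactor n N 0∈N m∈N 0≢m (sym 2m≡0)
  where
  n : ℕ
  n = 2 * suc k
  m<n : suc k < n
  m<n = m<m+n (suc k) {suc k + 0} (s≤s z≤n)
  m : Fin n
  m = fromℕ< m<n
  toℕ-m : toℕ m ≡ suc k
  toℕ-m = toℕ-fromℕ< m<n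
  0≢m : zero ≢ m
  0≢m 0≡m = 0≢1+n (trans (cong toℕ 0≡m) toℕ-m)
  2m≡0 : addMod n m m ≡ addMod n zero zero
  2m≡0 = ℤₙ.reduce-cong n {toℕ m + toℕ m} {0} (begin
    (toℕ m + toℕ m) % n     ≡⟨ cong (λ r → (r + r) % n) toℕ-m ⟩
    (suc k + suc k) % n     ≡⟨ cong (λ r → (suc k + r) % n) (+-identityʳ (suc k)) ⟨
    n % n                   ≡⟨ n%n≡0 n ⟩
    0                       ∎)
    where open ≡-Reasoning
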